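{- Let $\mathbb{M}=(M,\chi_M)$ be a monster model of $T_{pdg*}$, $(\Gamma,\chi)$ a small submodel of $\mathbb{M}$, $a\in M\setminus\Gamma$, and $\Delta_\Gamma=\{\chi_M(x+qa): q\in\mathbb{Q}\setminus\{0\},\ x\in\Gamma,\ x+qa<0\}$. Then exactly one of the following holds: (1) there is a nonempty special cut $B$ in $\chi(\Gamma^{<0})$ with $\Delta_\Gamma=B$; (2) there is $b\in\chi(\Gamma^{<0})$ with $\Delta_\Gamma=\{x\in\chi(\Gamma^{<0}):x\le b\}$; (3) there are a nonempty special cut $B$ in $\chi(\Gamma^{<0})$ and $b\in\chi_M(M^{<0})\setminus\chi(\Gamma^{<0})$ with $B<b<\chi(\Gamma^{<0})\setminus B$ and $\Delta_\Gamma=B\cup\{b\}$.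
   Context: For an ordered abelian group $\Gamma$, $\Gamma^{<0}=\{x\in\Gamma:x<0\}$, and $a,b$ are archimedean equivalent if $|a|\le n|b|$ and $|b|\le n|a|$ for some $n\ge1$. A precontraction group is a totally ordered abelian group $\Gamma$ with a map $\chi:\Gamma\to\Gamma$ such that for all $a,b$: (1) $\chi(a)=0\iff a=0$; (2) $a\le b\Rightarrow\chi(a)\le\chi(b)$; (3) $\chi(-a)=-\chi(a)$; (4) archimedean equivalent $a,b$ of the same sign have $\chi(a)=\chi(b)$. Centripetal: $|\chi(a)|<|a|$ for $a\neq0$. $T_{pdg}$ is the theory in $L_{pdg}=\{+,-,0,<,\chi,c\}$ of nontrivial centripetal precontraction groups with: (i) $\chi(\Gamma^{<0})$ has least element $c$; (ii) $\chi$ restricts to a bijection $\chi(\Gamma^{<0})\to\chi(\Gamma^{<0})^{>c}:=\{x\in\chi(\Gamma^{<0}):x>c\}$; (iii) for $a<b$ in $\chi(\Gamma^{<0})$, $a<\chi(a)\le b$; (iv) $\Gamma$ divisible. $L_{pdg*}=L_{pdg}\cup\{\infty,\chi^{ -1},\delta_1,\delta_2,\dots\}$; models of $T_{pdg}$ are viewed as $L_{pdg*}$-structures on $\Gamma\cup\{\infty\}$ with $x<\infty$, $\infty$ absorbing for $+$, $-\infty=\chi(\infty)=\infty$, $\delta_n$ division by $n$, $\chi^{ -1}$ the inverse of $\chi:\chi(\Gamma^{<0})\to\chi(\Gamma^{<0})^{>c}$ on $\chi(\Gamma^{<0})^{>c}$, $\chi^{ -1}(0)=0$, $\chi^{ -1}(c)=\infty$,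 $\chi^{ -1}(a)=\infty$ otherwise; $T_{pdg*}$ is the theory of these expansions. A special cut in $\chi(\Gamma^{<0})$ is a lower cut $G$ of the ordered set $\chi(\Gamma^{<0})$ (i.e. $b\in G$, $a\in\chi(\Gamma^{<0})$, $a<b$ imply $a\in G$) with $\chi(G)\subseteq G$. For sets, $A<b<B$ means every element of $A$ is below $b$ and $b$ is below every element of $B$. -}

module Defs where

open import Data.Nat using (ℕ; zero; suc)
open import Data.Integer using (ℤ; +_; -[1+_])
open import Data.Rational using (ℚ; 0ℚ)
open import Data.Maybe using (Maybe; just; nothing; map)
open import Data.Product using (Σ; _×_; _,_; ∃; ∃-syntax)
open import Data.Sum using (_⊎_)
open import Relation.Nullary using (¬_)
open import Relation.Binary.PropositionalEquality using (_≡_; _≢_)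

record Signature : Set₁ where
  infixl 6 _+_
  infix 4 _<_
  field
    Carrier : Set
    _+_ : Carrier → Carrier → Carrier
    -_  : Carrier → Carrier
    0#  : Carrier
    _<_ : Carrier → Carrier → Set
    χ   : Carrier → Carrier
    c   : Carrier

module Helpers (S : Signature) where
  open Signature S

  infix 4 _≤_
  _≤_ : Carrier → Carrier → Set
  x ≤ y = x < y ⊎ x ≡ y

  _·ℕ_ : ℕ → Carrier → Carrier
  zero  ·ℕ x = 0#
  suc n ·ℕ x = x + (n ·ℕ x)

  _·ℤ_ : ℤ → Carrier → Carrier
  (+ n)    ·ℤ x = n ·ℕ x
  -[1+ n ] ·ℤ x = - (suc n ·ℕ x)

  IsAbs : Carrier → Carrier → Set
  IsAbs x y = (0# ≤ x × y ≡ x) ⊎ (x < 0# × y ≡ - x)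

  ArchEquiv : Carrier → Carrier → Set
  ArchEquiv a b = Σ ℕ λ n → Σ Carrier λ u → Σ Carrier λ v →
    IsAbs a u × IsAbs b v × u ≤ (suc n ·ℕ v) × v ≤ (suc n ·ℕ u)

  SameSign : Carrier → Carrier → Set
  SameSign a b = (0# < a × 0# < b) ⊎ (a < 0# × b < 0#) ⊎ (a ≡ 0# × b ≡ 0#)

  InχNeg : Carrier → Set
  InχNeg y = Σ Carrier λ x → x < 0# × χ x ≡ y

  InχNeg>c : Carrier → Set
  InχNeg>c y = InχNeg y × c < y

  -- The graph of χ⁻¹ of L_pdg*, with ∞ represented by 'nothing':
  -- χ⁻¹(0) = 0; on χ(Γ^{<0})^{>c} it is the inverse of χ restricted to
  -- χ(Γ^{<0}); χ⁻¹(x) = ∞ otherwise (in particular χ⁻¹(c) = ∞).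
  -- (χ⁻¹(∞) = ∞ is automatic for embeddings and is not recorded.)
  ChiInv : Carrier → Maybe Carrier → Set
  ChiInv x r =
      (x ≡ 0# × r ≡ just 0#)
    ⊎ (InχNeg>c x × Σ Carrier λ y → InχNeg y × χ y ≡ x × r ≡ just y)
    ⊎ (x ≢ 0# × ¬ InχNeg>c x × r ≡ nothing)

-- Models of T_pdg (equivalently, of T_pdg*, whose extra symbols
-- ∞, χ⁻¹, δ_n are interpreted as described in the paper).
-- δ n x denotes division of x by (suc n), i.e. δ_{n+1}.

record IsTpdg (S : Signature) : Set where
  open Signature S
  open Helpers S
  field
    +-assoc     : ∀ x y z → (x + y) + z ≡ x + (y + z)
    +-comm      : ∀ x y → x + y ≡ y + x
    +-identityˡ : ∀ x → 0# + x ≡ x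
    -‿inverseˡ  : ∀ x → (- x) + x ≡ 0#
    <-irrefl    : ∀ x → ¬ (x < x)
    <-trans     : ∀ {x y z} → x < y → y < z → x < z
    <-total     : ∀ x y → x < y ⊎ x ≡ y ⊎ y < x
    +-mono-<    : ∀ {x y} z → x < y → x + z < y + z
    nontrivial  : Σ Carrier λ x → x ≢ 0#
    χ-zero⇒     : ∀ a → χ a ≡ 0# → a ≡ 0#
    χ-zero⇐     : ∀ a → a ≡ 0# → χ a ≡ 0#
    χ-mono      : ∀ {a b} → a ≤ b → χ a ≤ χ b
    χ-odd       : ∀ a → χ (- a) ≡ - χ a
    χ-arch      : ∀ a b → ArchEquiv a b → SameSign a b → χ a ≡ χ b
    centripetal : ∀ a → a ≢ 0# → ∀ u v → IsAbs (χ a) u → IsAbs a v → u < v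
    c-in        : InχNeg c
    c-least     : ∀ y → InχNeg y → c ≤ y
    χ-into      : ∀ y → InχNeg y → InχNeg>c (χ y)
    χ-inj       : ∀ y z → InχNeg y → InχNeg z → χ y ≡ χ z → y ≡ z
    χ-onto      : ∀ z → InχNeg>c z → Σ Carrier λ y → InχNeg y × χ y ≡ z
    χ-between   : ∀ a b → InχNeg a → InχNeg b → a < b → a < χ a × χ a ≤ b
    δ           : ℕ → Carrier → Carrier
    δ-spec      : ∀ n x → suc n ·ℕ δ n x ≡ x

record Model : Set₁ where
  field
    sig   : Signature
    isTpdg : IsTpdg sig
  open Signature sig public
  open Helpers sig public
  open IsTpdg isTpdg public

-- An L_pdg*-embedding Γ → M (so Γ, identified with its image, is a
-- substructure of M in the language L_pdg* which is a model of T_pdg*,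
-- i.e. a submodel).

record Embedding (G M : Model) : Set where
  private
    module G = Model G
    module M = Model M
  field
    f        : G.Carrier → M.Carrier
    f-inj    : ∀ x y → f x ≡ f y → x ≡ y
    f-+      : ∀ x y → f (x G.+ y) ≡ f x M.+ f y
    f--      : ∀ x → f (G.- x) ≡ M.- f x
    f-0      : f G.0# ≡ M.0#
    f-<      : ∀ x y → x G.< y → f x M.< f y
    f-<⁻¹    : ∀ x y → f x M.< f y → x G.< y
    f-χ      : ∀ x → f (G.χ x) ≡ M.χ (f x)
    f-c      : f G.c ≡ M.c
    f-δ      : ∀ n x → f (G.δ n x) ≡ M.δ n (f x)
    f-χ⁻¹    : ∀ x r → G.ChiInv x r → M.ChiInv (f x) (map f r)

module Setup (M : Model) where
  open Model M

  _·ℚ_ : ℚ → Carrier → Carrier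
  q ·ℚ a = ℚ.numerator q ·ℤ δ (ℚ.denominator-1 q) a

module _ {G M : Model} (e : Embedding G M) where
  private
    module G = Model G
    module M = Model M
  open Embedding e
  open Setup M

  Δ : M.Carrier → M.Carrier → Set
  Δ a y = Σ ℚ λ q → Σ G.Carrier λ x →
    q ≢ 0ℚ × (f x M.+ (q ·ℚ a)) M.< M.0# × M.χ (f x M.+ (q ·ℚ a)) ≡ y

  NonemptySpecialCut : (G.Carrier → Set) → Set
  NonemptySpecialCut B =
      (∀ x → B x → G.InχNeg x)
    × (∀ a b → B b → G.InχNeg a → a G.< b → B a)
    × (∀ x → B x → B (G.χ x))
    × Σ G.Carrier B

  _≐img_ : (M.Carrier → Set) → (G.Carrier → Set) → Set
  D ≐img B = ∀ y → (D y → Σ G.Carrier λ z → B z × f z ≡ y)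
                 × ((Σ G.Carrier λ z → B z × f z ≡ y) → D y)

  Case1 : M.Carrier → Set₁
  Case1 a = Σ (G.Carrier → Set) λ B → NonemptySpecialCut B × (Δ a ≐img B)

  Case2 : M.Carrier → Set
  Case2 a = Σ G.Carrier λ b → G.InχNeg b ×
    (Δ a ≐img (λ x → G.InχNeg x × x G.≤ b))

  Case3 : M.Carrier → Set₁
  Case3 a = Σ (G.Carrier → Set) λ B → NonemptySpecialCut B ×
    Σ M.Carrier λ b →
      M.InχNeg b
    × ¬ (Σ G.Carrier λ z → G.InχNeg z × f z ≡ b)
    × (∀ z → B z → f z M.< b)
    × (∀ z → G.InχNeg z → ¬ B z → b M.< f z)
    × (∀ y → (Δ a y → (Σ G.Carrier λ z → B z × f z ≡ y) ⊎ y ≡ b)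
           × ((Σ G.Carrier λ z → B z × f z ≡ y) ⊎ y ≡ b → Δ a y))

ExactlyOne : ∀ {a b d} → Set a → Set b → Set d → Set _
ExactlyOne P Q R = (P ⊎ Q ⊎ R) × ¬ (P × Q) × ¬ (P × R) × ¬ (Q × R)

-- The key tool is the map V x = χ(-|x|), which behaves like a valuation:
-- it ignores signs and nonzero integer multiples, and V x < V y implies
-- V (x + y) = V x.  Writing elements of Δ as V(x + q·a), two elements of
-- Δ can be combined (after clearing denominators) so that a cancels; this
-- shows that of two distinct elements of Δ the smaller one lies in Γ, and
-- adding suitable elements of Γ shows that Δ is closed downwards inside
-- χ(Γ^{<0}).  So at most one point of Δ lies outside Γ, and the trichotomy
-- follows by a (classical) case distinction on whether such a point exists
-- and whether Δ ∩ Γ has a maximum.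
module Submission where

open import Defs
open import Level using (0ℓ)
open import Axiom.ExcludedMiddle using (ExcludedMiddle)
open import Algebra.Bundles using (AbelianGroup)
open import Algebra.Structures using (IsAbelianGroup)
open import Algebra.Consequences.Propositional using (comm∧idˡ⇒idʳ; comm∧invˡ⇒invʳ)
import Algebra.Properties.AbelianGroup as AbelianGroupProperties
import Algebra.Properties.CommutativeMonoid.Mult as MultProperties
import Relation.Binary.Construct.StrictToNonStrict as StrictToNonStrict
open import Data.Product using (Σ; _×_; _,_; proj₁; proj₂)
open import Data.Sum using (_⊎_; inj₁; inj₂)
open import Data.Empty using (⊥-elim)
open import Function using (_∘_)
open import Data.Nat as ℕ using (ℕ; zero; suc)
import Data.Nat.Properties as ℕₚ
open import Data.Integer as ℤ using (ℤ; -[1+_])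
open import Data.Rational as ℚ using (ℚ; 0ℚ; 1ℚ)
import Data.Rational.Properties as ℚₚ
open import Data.Maybe using (nothing)
open import Relation.Nullary using (¬_; yes; no)
open import Relation.Binary.PropositionalEquality
  using (_≡_; _≢_; refl; sym; trans; cong; cong₂; subst; subst₂; resp₂; isEquivalence; module ≡-Reasoning)

module OrderedGroup (M : Model) where
  open Model M
  open ≡-Reasoning

  +-isAbelianGroup : IsAbelianGroup _≡_ _+_ 0# -_
  +-isAbelianGroup = record
    { isGroup = record
      { isMonoid = record
        { isSemigroup = record
          { isMagma = record { isEquivalence = isEquivalence ; ∙-cong = cong₂ _+_ }
          ; assoc = +-assoc }
        ; identity = +-identityˡ , comm∧idˡ⇒idʳ +-comm +-identityˡ }
      ; inverse = -‿inverseˡ , comm∧invˡ⇒invʳ +-comm -‿inverseˡ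
      ; ⁻¹-cong = cong -_ }
    ; comm = +-comm }

  +-abelianGroup : AbelianGroup 0ℓ 0ℓ
  +-abelianGroup = record { isAbelianGroup = +-isAbelianGroup }

  open AbelianGroup +-abelianGroup public
    using () renaming (identityʳ to +-identityʳ; inverseʳ to -‿inverseʳ)
  open AbelianGroupProperties +-abelianGroup public
    using () renaming (⁻¹-involutive to neg-involutive; ε⁻¹≈ε to neg-0; inverseʳ-unique to neg-unique)

  neg-+ : ∀ x y → - (x + y) ≡ - x + - y
  neg-+ x y = sym (AbelianGroupProperties.⁻¹-∙-comm +-abelianGroup x y)

  +-cancel-neg : ∀ x y → (x + y) + - y ≡ x
  +-cancel-neg x y = begin
    (x + y) + - y  ≡⟨ +-assoc x y (- y) ⟩
    x + (y + - y)  ≡⟨ cong (x +_) (-‿inverseʳ y) ⟩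
    x + 0#         ≡⟨ +-identityʳ x ⟩
    x              ∎

  +-cancel-common : ∀ x y t → (x + t) + - (y + t) ≡ x + - y
  +-cancel-common x y t = begin
    (x + t) + - (y + t)    ≡⟨ cong ((x + t) +_) (neg-+ y t) ⟩
    (x + t) + (- y + - t)  ≡⟨ cong ((x + t) +_) (+-comm (- y) (- t)) ⟩
    (x + t) + (- t + - y)  ≡⟨ sym (+-assoc (x + t) (- t) (- y)) ⟩
    ((x + t) + - t) + - y  ≡⟨ cong (_+ - y) (+-cancel-neg x t) ⟩
    x + - y                ∎

  open MultProperties (AbelianGroup.commutativeMonoid +-abelianGroup)
    using (×-assocˡ; ×-distrib-+) renaming (_×_ to _×ₙ_)

  ·ℕ-is-× : ∀ n x → n ·ℕ x ≡ n ×ₙ x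
  ·ℕ-is-× zero    x = refl
  ·ℕ-is-× (suc n) x = cong (x +_) (·ℕ-is-× n x)

  ·ℕ-distrib : ∀ n x y → n ·ℕ (x + y) ≡ n ·ℕ x + n ·ℕ y
  ·ℕ-distrib n x y = begin
    n ·ℕ (x + y)          ≡⟨ ·ℕ-is-× n (x + y) ⟩
    n ×ₙ (x + y)          ≡⟨ ×-distrib-+ x y n ⟩
    n ×ₙ x + n ×ₙ y       ≡⟨ sym (cong₂ _+_ (·ℕ-is-× n x) (·ℕ-is-× n y)) ⟩
    n ·ℕ x + n ·ℕ y       ∎

  ·ℕ-comm : ∀ m n x → m ·ℕ (n ·ℕ x) ≡ n ·ℕ (m ·ℕ x)
  ·ℕ-comm m n x = begin
    m ·ℕ (n ·ℕ x)         ≡⟨ trans (·ℕ-is-× m _) (cong (m ×ₙ_) (·ℕ-is-× n x)) ⟩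
    m ×ₙ (n ×ₙ x)         ≡⟨ ×-assocˡ x m n ⟩
    (m ℕ.* n) ×ₙ x        ≡⟨ cong (_×ₙ x) (ℕₚ.*-comm m n) ⟩
    (n ℕ.* m) ×ₙ x        ≡⟨ sym (×-assocˡ x n m) ⟩
    n ×ₙ (m ×ₙ x)         ≡⟨ sym (trans (·ℕ-is-× n _) (cong (n ×ₙ_) (·ℕ-is-× m x))) ⟩
    n ·ℕ (m ·ℕ x)         ∎

  ·ℕ-0 : ∀ n → n ·ℕ 0# ≡ 0#
  ·ℕ-0 zero    = refl
  ·ℕ-0 (suc n) = trans (cong (0# +_) (·ℕ-0 n)) (+-identityˡ 0#)

  ·ℕ-neg : ∀ n x → n ·ℕ (- x) ≡ - (n ·ℕ x)
  ·ℕ-neg n x = neg-unique (n ·ℕ x) (n ·ℕ (- x)) (begin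
    n ·ℕ x + n ·ℕ (- x)   ≡⟨ sym (·ℕ-distrib n x (- x)) ⟩
    n ·ℕ (x + - x)        ≡⟨ cong (n ·ℕ_) (-‿inverseʳ x) ⟩
    n ·ℕ 0#               ≡⟨ ·ℕ-0 n ⟩
    0#                    ∎)

  ·ℤ-neg : ∀ t x → t ·ℤ (- x) ≡ - (t ·ℤ x)
  ·ℤ-neg (ℤ.+ n)  x = ·ℕ-neg n x
  ·ℤ-neg -[1+ n ] x = cong -_ (·ℕ-neg (suc n) x)

  ·ℤ-distrib : ∀ t x y → t ·ℤ (x + y) ≡ t ·ℤ x + t ·ℤ y
  ·ℤ-distrib (ℤ.+ n)  x y = ·ℕ-distrib n x y
  ·ℤ-distrib -[1+ n ] x y = trans (cong -_ (·ℕ-distrib (suc n) x y)) (neg-+ _ _)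

  ·ℕℤ-comm : ∀ m t x → m ·ℕ (t ·ℤ x) ≡ t ·ℤ (m ·ℕ x)
  ·ℕℤ-comm m (ℤ.+ n)  x = ·ℕ-comm m n x
  ·ℕℤ-comm m -[1+ n ] x = trans (·ℕ-neg m _) (cong -_ (·ℕ-comm m (suc n) x))

  ·ℤ-comm : ∀ s t x → s ·ℤ (t ·ℤ x) ≡ t ·ℤ (s ·ℤ x)
  ·ℤ-comm (ℤ.+ m)  t x = ·ℕℤ-comm m t x
  ·ℤ-comm -[1+ m ] t x = trans (cong -_ (·ℕℤ-comm (suc m) t x)) (sym (·ℤ-neg t _))

  private
    <-irrefl≡ : ∀ {x y} → x ≡ y → ¬ (x < y)
    <-irrefl≡ refl = <-irrefl _

  ≤-trans : ∀ {x y z} → x ≤ y → y ≤ z → x ≤ z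
  ≤-trans = StrictToNonStrict.trans _≡_ _<_ isEquivalence (resp₂ _<_) <-trans

  ≤-antisym : ∀ {x y} → x ≤ y → y ≤ x → x ≡ y
  ≤-antisym = StrictToNonStrict.antisym _≡_ _<_ isEquivalence <-trans <-irrefl≡

  <-≤-trans : ∀ {x y z} → x < y → y ≤ z → x < z
  <-≤-trans = StrictToNonStrict.<-≤-trans _≡_ _<_ <-trans (proj₁ (resp₂ _<_))

  ≤-<-trans : ∀ {x y z} → x ≤ y → y < z → x < z
  ≤-<-trans = StrictToNonStrict.≤-<-trans _≡_ _<_ sym <-trans (proj₂ (resp₂ _<_))

  +-monoˡ-≤ : ∀ {x y} z → x ≤ y → x + z ≤ y + z
  +-monoˡ-≤ z (inj₁ x<y) = inj₁ (+-mono-< z x<y)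
  +-monoˡ-≤ z (inj₂ refl) = inj₂ refl

  +-monoʳ-≤ : ∀ {x y} z → x ≤ y → z + x ≤ z + y
  +-monoʳ-≤ {x} {y} z x≤y = subst₂ _≤_ (+-comm x z) (+-comm y z) (+-monoˡ-≤ z x≤y)

  +-mono-≤ : ∀ {x y u v} → x ≤ y → u ≤ v → x + u ≤ y + v
  +-mono-≤ {y = y} x≤y u≤v = ≤-trans (+-monoˡ-≤ _ x≤y) (+-monoʳ-≤ y u≤v)

  neg-anti-< : ∀ {x y} → x < y → - y < - x
  neg-anti-< {x} {y} x<y = subst₂ _<_ shift-x shift-y (+-mono-< (- x + - y) x<y)
    where
    shift-x : x + (- x + - y) ≡ - y
    shift-x = trans (sym (+-assoc x (- x) (- y)))
                (trans (cong (_+ - y) (-‿inverseʳ x)) (+-identityˡ (- y)))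
    shift-y : y + (- x + - y) ≡ - x
    shift-y = trans (cong (y +_) (+-comm (- x) (- y))) (begin
      y + (- y + - x)   ≡⟨ sym (+-assoc y (- y) (- x)) ⟩
      (y + - y) + - x   ≡⟨ cong (_+ - x) (-‿inverseʳ y) ⟩
      0# + - x          ≡⟨ +-identityˡ (- x) ⟩
      - x               ∎)

  pos⇒neg : ∀ {x} → 0# < x → - x < 0#
  pos⇒neg 0<x = subst (_ <_) neg-0 (neg-anti-< 0<x)

  neg⇒pos : ∀ {x} → x < 0# → 0# < - x
  neg⇒pos x<0 = subst (_< _) neg-0 (neg-anti-< x<0)

  neg-reflects-pos : ∀ {x} → - x < 0# → 0# < x
  neg-reflects-pos {x} -x<0 = subst (0# <_) (neg-involutive x) (neg⇒pos -x<0)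

  ·ℕ-nonpos : ∀ n {x} → x ≤ 0# → n ·ℕ x ≤ 0#
  ·ℕ-nonpos zero    x≤0 = inj₂ refl
  ·ℕ-nonpos (suc n) {x} x≤0 = subst (x + n ·ℕ x ≤_) (+-identityˡ 0#) (+-mono-≤ x≤0 (·ℕ-nonpos n x≤0))

  ·ℕ-nonneg : ∀ n {x} → 0# ≤ x → 0# ≤ n ·ℕ x
  ·ℕ-nonneg zero    0≤x = inj₂ refl
  ·ℕ-nonneg (suc n) {x} 0≤x = subst (_≤ x + n ·ℕ x) (+-identityˡ 0#) (+-mono-≤ 0≤x (·ℕ-nonneg n 0≤x))

  ·ℕ-neg< : ∀ n {x} → x < 0# → suc n ·ℕ x < 0#
  ·ℕ-neg< n {x} x<0 =
    ≤-<-trans (subst (x + n ·ℕ x ≤_) (+-identityʳ x) (+-monoʳ-≤ x (·ℕ-nonpos n (inj₁ x<0)))) x<0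

  ·ℕ-pos> : ∀ n {x} → 0# < x → 0# < suc n ·ℕ x
  ·ℕ-pos> n {x} 0<x =
    neg-reflects-pos (subst (_< 0#) (·ℕ-neg (suc n) x) (·ℕ-neg< n (pos⇒neg 0<x)))

  ≤-·ℕ : ∀ n {p} → 0# ≤ p → p ≤ suc n ·ℕ p
  ≤-·ℕ n {p} 0≤p = subst (_≤ p + n ·ℕ p) (+-identityʳ p) (+-monoʳ-≤ p (·ℕ-nonneg n 0≤p))

module Valuation (M : Model) where
  open Model M
  open OrderedGroup M
  open ≡-Reasoning

  abstract
    nabs : Carrier → Carrier
    nabs x with <-total x 0#
    ... | inj₂ (inj₂ _) = - x
    ... | inj₁ _        = x
    ... | inj₂ (inj₁ _) = x

    nabs-spec : ∀ x → (x ≤ 0# × nabs x ≡ x) ⊎ (0# < x × nabs x ≡ - x)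
    nabs-spec x with <-total x 0#
    ... | inj₁ x<0        = inj₁ (inj₁ x<0 , refl)
    ... | inj₂ (inj₁ x≡0) = inj₁ (inj₂ x≡0 , refl)
    ... | inj₂ (inj₂ 0<x) = inj₂ (0<x , refl)

  nabs-nonpos : ∀ {x} → x ≤ 0# → nabs x ≡ x
  nabs-nonpos {x} x≤0 with nabs-spec x
  ... | inj₁ (_ , eq)   = eq
  ... | inj₂ (0<x , _)  = ⊥-elim (<-irrefl _ (<-≤-trans 0<x x≤0))

  nabs-pos : ∀ {x} → 0# < x → nabs x ≡ - x
  nabs-pos {x} 0<x with nabs-spec x
  ... | inj₁ (x≤0 , _)  = ⊥-elim (<-irrefl _ (<-≤-trans 0<x x≤0))
  ... | inj₂ (_ , eq)   = eq

  nonpos≤neg : ∀ {x} → x ≤ 0# → x ≤ - x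
  nonpos≤neg (inj₁ x<0)  = inj₁ (<-trans x<0 (neg⇒pos x<0))
  nonpos≤neg (inj₂ refl) = inj₂ (sym neg-0)

  nabs-≤0 : ∀ x → nabs x ≤ 0#
  nabs-≤0 x with nabs-spec x
  ... | inj₁ (x≤0 , eq) = subst (_≤ 0#) (sym eq) x≤0
  ... | inj₂ (0<x , eq) = inj₁ (subst (_< 0#) (sym eq) (pos⇒neg 0<x))

  nabs-lower : ∀ x → nabs x ≤ x × nabs x ≤ - x
  nabs-lower x with nabs-spec x
  ... | inj₁ (x≤0 , eq) rewrite eq = inj₂ refl , nonpos≤neg x≤0
  ... | inj₂ (0<x , eq) rewrite eq = inj₁ (<-trans (pos⇒neg 0<x) 0<x) , inj₂ refl

  nabs-neg : ∀ x → nabs (- x) ≡ nabs x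
  nabs-neg x with nabs-spec x
  ... | inj₁ (inj₁ x<0 , eq)  = trans (nabs-pos (neg⇒pos x<0)) (trans (neg-involutive x) (sym eq))
  ... | inj₁ (inj₂ refl , eq) = cong nabs neg-0
  ... | inj₂ (0<x , eq)       = trans (nabs-nonpos (inj₁ (pos⇒neg 0<x))) (sym eq)

  nabs<0 : ∀ {x} → x ≢ 0# → nabs x < 0#
  nabs<0 {x} x≢0 with nabs-spec x
  ... | inj₁ (inj₁ x<0 , eq)  = subst (_< 0#) (sym eq) x<0
  ... | inj₁ (inj₂ x≡0 , _)   = ⊥-elim (x≢0 x≡0)
  ... | inj₂ (0<x , eq)       = subst (_< 0#) (sym eq) (pos⇒neg 0<x)

  nabs-·ℕ : ∀ n x → nabs (suc n ·ℕ x) ≡ suc n ·ℕ nabs x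
  nabs-·ℕ n x with nabs-spec x
  ... | inj₁ (x≤0 , eq) = trans (nabs-nonpos (·ℕ-nonpos (suc n) x≤0)) (cong (suc n ·ℕ_) (sym eq))
  ... | inj₂ (0<x , eq) = trans (nabs-pos (·ℕ-pos> n 0<x))
                            (trans (sym (·ℕ-neg (suc n) x)) (cong (suc n ·ℕ_) (sym eq)))

  nabs-+ : ∀ x y → nabs x + nabs y ≤ nabs (x + y)
  nabs-+ x y with nabs-spec (x + y)
  ... | inj₁ (_ , eq) = subst (nabs x + nabs y ≤_) (sym eq)
                          (+-mono-≤ (proj₁ (nabs-lower x)) (proj₁ (nabs-lower y)))
  ... | inj₂ (_ , eq) = subst (nabs x + nabs y ≤_) (sym (trans eq (neg-+ x y)))
                          (+-mono-≤ (proj₂ (nabs-lower x)) (proj₂ (nabs-lower y)))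

  V : Carrier → Carrier
  V x = χ (nabs x)

  V-nonpos : ∀ {x} → x ≤ 0# → V x ≡ χ x
  V-nonpos x≤0 = cong χ (nabs-nonpos x≤0)

  V-neg : ∀ x → V (- x) ≡ V x
  V-neg x = cong χ (nabs-neg x)

  -- Axiom (4): a non-positive x and (n+1)·x are archimedean equivalent.
  χ-·ℕ : ∀ n {x} → x ≤ 0# → χ (suc n ·ℕ x) ≡ χ x
  χ-·ℕ n (inj₂ refl) = cong χ (·ℕ-0 (suc n))
  χ-·ℕ n {x} (inj₁ x<0) = χ-arch (suc n ·ℕ x) x
      (n , - (suc n ·ℕ x) , - x , inj₂ (·ℕ-neg< n x<0 , refl) , inj₂ (x<0 , refl) ,
       inj₂ (sym (·ℕ-neg (suc n) x)) , -x≤twice)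
      (inj₂ (inj₁ (·ℕ-neg< n x<0 , x<0)))
    where
    0≤-x : 0# ≤ - x
    0≤-x = inj₁ (neg⇒pos x<0)
    -x≤twice : - x ≤ suc n ·ℕ (- (suc n ·ℕ x))
    -x≤twice = subst (λ t → - x ≤ suc n ·ℕ t) (·ℕ-neg (suc n) x)
                 (≤-trans (≤-·ℕ n 0≤-x) (≤-·ℕ n (·ℕ-nonneg (suc n) 0≤-x)))

  V-·ℕ : ∀ n x → V (suc n ·ℕ x) ≡ V x
  V-·ℕ n x = trans (cong χ (nabs-·ℕ n x)) (χ-·ℕ n (nabs-≤0 x))

  V-·ℤ : ∀ t x → t ≢ ℤ.+ 0 → V (t ·ℤ x) ≡ V x
  V-·ℤ (ℤ.+ zero)  x t≢0 = ⊥-elim (t≢0 refl)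
  V-·ℤ (ℤ.+ suc n) x t≢0 = V-·ℕ n x
  V-·ℤ -[1+ n ]    x t≢0 = trans (V-neg _) (V-·ℕ n x)

  -- If -|z| - |z| ≤ -|x| - |y| then V z = χ(-|z| - |z|) ≤ χ(-|x + y|) = V (x + y).
  V-below-sum : ∀ z x y → nabs z + nabs z ≤ nabs x + nabs y → V z ≤ V (x + y)
  V-below-sum z x y le = subst (_≤ V (x + y)) (χ-·ℕ 1 (nabs-≤0 z))
    (χ-mono (≤-trans (subst (_≤ nabs x + nabs y) (cong (nabs z +_) (sym (+-identityʳ (nabs z)))) le)
                     (nabs-+ x y)))

  V-ultra : ∀ x y → V x ≤ V (x + y) ⊎ V y ≤ V (x + y)
  V-ultra x y with <-total (nabs x) (nabs y)
  ... | inj₁ lt        = inj₁ (V-below-sum x x y (+-monoʳ-≤ (nabs x) (inj₁ lt)))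
  ... | inj₂ (inj₁ eq) = inj₁ (V-below-sum x x y (+-monoʳ-≤ (nabs x) (inj₂ eq)))
  ... | inj₂ (inj₂ gt) = inj₂ (V-below-sum y x y (+-monoˡ-≤ (nabs y) (inj₁ gt)))

  V-dominant : ∀ x y → V x < V y → V (x + y) ≡ V x
  V-dominant x y Vx<Vy = ≤-antisym upper lower
    where
    lower : V x ≤ V (x + y)
    lower with V-ultra x y
    ... | inj₁ le = le
    ... | inj₂ le = inj₁ (<-≤-trans Vx<Vy le)
    upper : V (x + y) ≤ V x
    upper with V-ultra (x + y) (- y)
    ... | inj₁ le = subst (λ t → V (x + y) ≤ V t) (+-cancel-neg x y) le
    ... | inj₂ le = ⊥-elim (<-irrefl _ (<-≤-trans Vx<Vy
                      (subst₂ _≤_ (V-neg y) (cong V (+-cancel-neg x y)) le)))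

  -- Clearing both summands by nonzero multiples does not change which one
  -- dominates; this is how the element a gets eliminated below.
  V-dominant-combination : ∀ {s w} (m m' : ℤ) (j j' : ℕ) → m ≢ ℤ.+ 0 → m' ≢ ℤ.+ 0 →
    V w < V s → V (m ·ℤ (suc j ·ℕ s) + - (m' ·ℤ (suc j' ·ℕ w))) ≡ V w
  V-dominant-combination {s} {w} m m' j j' m≢0 m'≢0 Vw<Vs = begin
    V (u + - v)   ≡⟨ cong V (+-comm u (- v)) ⟩
    V (- v + u)   ≡⟨ V-dominant (- v) u (subst₂ _<_ (sym V-v) (sym Vu) Vw<Vs) ⟩
    V (- v)       ≡⟨ V-v ⟩
    V w           ∎
    where
    u = m ·ℤ (suc j ·ℕ s)
    v = m' ·ℤ (suc j' ·ℕ w)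
    Vu : V u ≡ V s
    Vu = trans (V-·ℤ m _ m≢0) (V-·ℕ j s)
    V-v : V (- v) ≡ V w
    V-v = trans (V-neg v) (trans (V-·ℤ m' _ m'≢0) (V-·ℕ j' w))

  χNeg<0 : ∀ {y} → InχNeg y → y < 0#
  χNeg<0 (x , x<0 , refl) with χ-mono (inj₁ x<0)
  ... | inj₁ χx<χ0 = subst (_ <_) (χ-zero⇐ 0# refl) χx<χ0
  ... | inj₂ χx≡χ0 = ⊥-elim (<-irrefl _
                       (subst (_< 0#) (χ-zero⇒ x (trans χx≡χ0 (χ-zero⇐ 0# refl))) x<0))

  χNeg<χ : ∀ {b} → InχNeg b → b < χ b
  χNeg<χ {b} b∈ = subst₂ _<_ (neg-involutive b) (neg-involutive (χ b)) (neg-anti-< -χb<-b)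
    where
    b<0 = χNeg<0 b∈
    -χb<-b : - χ b < - b
    -χb<-b = centripetal b (λ b≡0 → <-irrefl _ (subst (_< 0#) b≡0 b<0)) (- χ b) (- b)
               (inj₂ (χNeg<0 (proj₁ (χ-into b b∈)) , refl)) (inj₂ (b<0 , refl))

-- An L_pdg*-embedding f : Γ → M commutes with multiples and with V, and,
-- classically, reflects membership in χ(Γ^{<0}) (this uses that f
-- preserves χ⁻¹, in particular the value ∞ = χ⁻¹(x) for x ∉ χ(Γ^{<0})^{>c}).
module EmbeddingFacts {G M : Model} (e : Embedding G M) where
  private
    module G = Model G
    module M = Model M
    module VG = Valuation G
    module VM = Valuation M
  open Embedding e

  f-neg : ∀ {x} → x G.< G.0# → f x M.< M.0#
  f-neg {x} x<0 = subst (f x M.<_) f-0 (f-< x G.0# x<0)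

  f-pos : ∀ {x} → G.0# G.< x → M.0# M.< f x
  f-pos {x} 0<x = subst (M._< f x) f-0 (f-< G.0# x 0<x)

  f-·ℕ : ∀ n x → f (n G.·ℕ x) ≡ n M.·ℕ f x
  f-·ℕ zero    x = f-0
  f-·ℕ (suc n) x = trans (f-+ x _) (cong (f x M.+_) (f-·ℕ n x))

  f-·ℤ : ∀ t x → f (t G.·ℤ x) ≡ t M.·ℤ f x
  f-·ℤ (ℤ.+ n)  x = f-·ℕ n x
  f-·ℤ -[1+ n ] x = trans (f-- _) (cong M.-_ (f-·ℕ (suc n) x))

  f-nabs : ∀ y → f (VG.nabs y) ≡ VM.nabs (f y)
  f-nabs y with VG.nabs-spec y
  ... | inj₁ (inj₁ y<0 , eq)  = trans (cong f eq) (sym (VM.nabs-nonpos (inj₁ (f-neg y<0))))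
  ... | inj₁ (inj₂ refl , eq) = trans (cong f eq) (sym (VM.nabs-nonpos (inj₂ f-0)))
  ... | inj₂ (0<y , eq)       = trans (cong f eq) (trans (f-- y) (sym (VM.nabs-pos (f-pos 0<y))))

  f-V : ∀ y → f (VG.V y) ≡ VM.V (f y)
  f-V y = trans (f-χ (VG.nabs y)) (cong M.χ (f-nabs y))

  f-reflects-χNeg : ExcludedMiddle 0ℓ → ∀ z → M.InχNeg (f z) → G.InχNeg z
  f-reflects-χNeg lem z fz∈ with lem {G.InχNeg z}
  ... | yes z∈ = z∈
  ... | no z∉ = ⊥-elim (no-χ⁻¹-value (f-χ⁻¹ z nothing (inj₂ (inj₂ (z≢0 , (λ z∈>c → z∉ (proj₁ z∈>c)) , refl)))))
    where
    z≢0 : z ≢ G.0#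
    z≢0 z≡0 = M.<-irrefl _ (subst (M._< M.0#) (trans (cong f z≡0) f-0) (VM.χNeg<0 fz∈))
    -- In M, f z ∈ χ(M^{<0}) and f z ≠ c (else z = c), so χ⁻¹(f z) is finite.
    no-χ⁻¹-value : ¬ M.ChiInv (f z) nothing
    no-χ⁻¹-value (inj₁ (_ , ()))
    no-χ⁻¹-value (inj₂ (inj₁ (_ , _ , _ , _ , ())))
    no-χ⁻¹-value (inj₂ (inj₂ (_ , fz∉>c , _))) with M.c-least (f z) fz∈
    ... | inj₁ c<fz = fz∉>c (fz∈ , c<fz)
    ... | inj₂ c≡fz = z∉ (subst G.InχNeg (f-inj _ _ (trans f-c c≡fz)) G.c-in)

-- Writing its elements as
-- χ(s) = V(s) with s = x + q·a < 0, the three basic facts are: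
--   * Δ is nonempty (take s = ±a);
--   * Δ is closed downwards inside f(χ(Γ^{<0})) (add an element of Γ of
--     smaller value to s);
--   * of two distinct elements of Δ the smaller one lies in f(χ(Γ^{<0}))
--     (eliminate a from a combination of the two and use V-dominant).
module DeltaSet {G M : Model} (e : Embedding G M) (a : Model.Carrier M)
                (a∉Γ : ¬ (Σ (Model.Carrier G) λ x → Embedding.f e x ≡ a)) where
  private
    module G = Model G
    module M = Model M
    module OM = OrderedGroup M
    module VG = Valuation G
    module VM = Valuation M
  open Embedding e
  open EmbeddingFacts e
  open Setup M
  open ≡-Reasoning

  numerator≢0 : ∀ {q} → q ≢ 0ℚ → ℚ.numerator q ≢ ℤ.+ 0
  numerator≢0 {q} q≢0 n≡0 = q≢0 (ℚₚ.↥p≡0⇒p≡0 q n≡0)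

  clear-denominator : ∀ q x → let n = ℚ.numerator q ; k = ℚ.denominator-1 q in
    suc k M.·ℕ (f x M.+ q ·ℚ a) ≡ f (suc k G.·ℕ x) M.+ n M.·ℤ a
  clear-denominator q x = begin
    suc k M.·ℕ (f x M.+ n M.·ℤ M.δ k a)
      ≡⟨ OM.·ℕ-distrib (suc k) (f x) _ ⟩
    suc k M.·ℕ f x M.+ suc k M.·ℕ (n M.·ℤ M.δ k a)
      ≡⟨ cong₂ M._+_ (sym (f-·ℕ (suc k) x)) (OM.·ℕℤ-comm (suc k) n (M.δ k a)) ⟩
    f (suc k G.·ℕ x) M.+ n M.·ℤ (suc k M.·ℕ M.δ k a)
      ≡⟨ cong (λ t → f (suc k G.·ℕ x) M.+ n M.·ℤ t) (M.δ-spec k a) ⟩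
    f (suc k G.·ℕ x) M.+ n M.·ℤ a
      ∎
    where
    n = ℚ.numerator q
    k = ℚ.denominator-1 q

  eliminate-a : ∀ q x q' x' →
    let n = ℚ.numerator q ; k = ℚ.denominator-1 q
        n' = ℚ.numerator q' ; k' = ℚ.denominator-1 q' in
    n' M.·ℤ (suc k M.·ℕ (f x M.+ q ·ℚ a)) M.+ M.- (n M.·ℤ (suc k' M.·ℕ (f x' M.+ q' ·ℚ a)))
      ≡ f (n' G.·ℤ (suc k G.·ℕ x) G.+ G.- (n G.·ℤ (suc k' G.·ℕ x')))
  eliminate-a q x q' x' = begin
    n' M.·ℤ (suc k M.·ℕ (f x M.+ q ·ℚ a)) M.+ M.- (n M.·ℤ (suc k' M.·ℕ (f x' M.+ q' ·ℚ a)))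
      ≡⟨ cong₂ (λ s w → n' M.·ℤ s M.+ M.- (n M.·ℤ w)) (clear-denominator q x) (clear-denominator q' x') ⟩
    n' M.·ℤ (f X M.+ n M.·ℤ a) M.+ M.- (n M.·ℤ (f X' M.+ n' M.·ℤ a))
      ≡⟨ cong₂ (λ s w → s M.+ M.- w) (OM.·ℤ-distrib n' (f X) _) (OM.·ℤ-distrib n (f X') _) ⟩
    (n' M.·ℤ f X M.+ common) M.+ M.- (n M.·ℤ f X' M.+ n M.·ℤ (n' M.·ℤ a))
      ≡⟨ cong (λ t → (n' M.·ℤ f X M.+ common) M.+ M.- (n M.·ℤ f X' M.+ t)) (OM.·ℤ-comm n n' a) ⟩
    (n' M.·ℤ f X M.+ common) M.+ M.- (n M.·ℤ f X' M.+ common)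
      ≡⟨ OM.+-cancel-common _ _ common ⟩
    n' M.·ℤ f X M.+ M.- (n M.·ℤ f X')
      ≡⟨ sym (cong₂ M._+_ (f-·ℤ n' X) (trans (f-- _) (cong M.-_ (f-·ℤ n X')))) ⟩
    f (n' G.·ℤ X) M.+ f (G.- (n G.·ℤ X'))
      ≡⟨ sym (f-+ _ _) ⟩
    f (n' G.·ℤ X G.+ G.- (n G.·ℤ X'))
      ∎
    where
    n = ℚ.numerator q
    k = ℚ.denominator-1 q
    n' = ℚ.numerator q'
    k' = ℚ.denominator-1 q'
    X = suc k G.·ℕ x
    X' = suc k' G.·ℕ x'
    common = n' M.·ℤ (n M.·ℤ a)

  InImage : M.Carrier → Set
  InImage y = Σ G.Carrier λ z → f z ≡ y

  Δ⊆χNeg : ∀ {d} → Δ e a d → M.InχNeg d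
  Δ⊆χNeg (_ , _ , _ , s<0 , χs≡d) = _ , s<0 , χs≡d

  Δ-nonempty : Σ M.Carrier (Δ e a)
  Δ-nonempty with M.<-total a M.0#
  ... | inj₁ a<0        = _ , 1ℚ , G.0# , ℚₚ.1≢0 , subst (M._< M.0#) (sym a≡1·a) a<0 , refl
    where
    a≡1·a : f G.0# M.+ 1ℚ ·ℚ a ≡ a
    a≡1·a = trans (cong₂ M._+_ f-0 (M.δ-spec 0 a)) (M.+-identityˡ a)
  ... | inj₂ (inj₁ a≡0) = ⊥-elim (a∉Γ (G.0# , trans f-0 (sym a≡0)))
  ... | inj₂ (inj₂ 0<a) = _ , ℚ.- 1ℚ , G.0# , (λ ()) , subst (M._< M.0#) (sym -a≡-1·a) (OM.pos⇒neg 0<a) , refl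
    where
    -a≡-1·a : f G.0# M.+ (ℚ.- 1ℚ) ·ℚ a ≡ M.- a
    -a≡-1·a = trans (cong₂ M._+_ f-0 (cong M.-_ (M.δ-spec 0 a))) (M.+-identityˡ (M.- a))

  Δ-smaller-in-image : ∀ {d₁ d₂} → Δ e a d₁ → Δ e a d₂ → d₂ M.< d₁ →
    Σ G.Carrier λ g → G.InχNeg g × f g ≡ d₂
  Δ-smaller-in-image {d₁} {d₂} (q , x , q≢0 , s<0 , χs≡d₁) Δd₂@(q' , x' , q'≢0 , w<0 , χw≡d₂) d₂<d₁ =
    G.χ (VG.nabs h) , (VG.nabs h , VG.nabs<0 h≢0 , refl) , trans (f-V h) Vfh≡d₂
    where
    h = ℚ.numerator q' G.·ℤ (suc (ℚ.denominator-1 q) G.·ℕ x)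
          G.+ G.- (ℚ.numerator q G.·ℤ (suc (ℚ.denominator-1 q') G.·ℕ x'))
    Vs≡d₁ : VM.V (f x M.+ q ·ℚ a) ≡ d₁
    Vs≡d₁ = trans (VM.V-nonpos (inj₁ s<0)) χs≡d₁
    Vw≡d₂ : VM.V (f x' M.+ q' ·ℚ a) ≡ d₂
    Vw≡d₂ = trans (VM.V-nonpos (inj₁ w<0)) χw≡d₂
    Vfh≡d₂ : VM.V (f h) ≡ d₂
    Vfh≡d₂ = begin
      VM.V (f h)   ≡⟨ cong VM.V (sym (eliminate-a q x q' x')) ⟩
      VM.V _       ≡⟨ VM.V-dominant-combination _ _ (ℚ.denominator-1 q) (ℚ.denominator-1 q') (numerator≢0 q'≢0) (numerator≢0 q≢0)
                        (subst₂ M._<_ (sym Vw≡d₂) (sym Vs≡d₁) d₂<d₁) ⟩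
      VM.V (f x' M.+ q' ·ℚ a) ≡⟨ Vw≡d₂ ⟩
      d₂           ∎
    -- h ≠ 0, since V(f h) = d₂ < 0 = V 0.
    h≢0 : h ≢ G.0#
    h≢0 h≡0 = M.<-irrefl _ (subst (M._< M.0#) d₂≡0 (VM.χNeg<0 (Δ⊆χNeg Δd₂)))
      where
      d₂≡0 : d₂ ≡ M.0#
      d₂≡0 = trans (sym Vfh≡d₂) (trans (cong (VM.V ∘ f) h≡0)
               (trans (cong VM.V f-0) (trans (VM.V-nonpos (inj₂ refl)) (M.χ-zero⇐ M.0# refl))))

  Δ-unique-outside-image : ∀ {d₁ d₂} → Δ e a d₁ → Δ e a d₂ → ¬ InImage d₁ → ¬ InImage d₂ → d₁ ≡ d₂
  Δ-unique-outside-image {d₁} {d₂} Δd₁ Δd₂ d₁∉ d₂∉ with M.<-total d₁ d₂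
  ... | inj₁ d₁<d₂ = let (g , _ , fg≡d₁) = Δ-smaller-in-image Δd₂ Δd₁ d₁<d₂ in ⊥-elim (d₁∉ (g , fg≡d₁))
  ... | inj₂ (inj₁ d₁≡d₂) = d₁≡d₂
  ... | inj₂ (inj₂ d₂<d₁) = let (g , _ , fg≡d₂) = Δ-smaller-in-image Δd₁ Δd₂ d₂<d₁ in ⊥-elim (d₂∉ (g , fg≡d₂))

  -- Δ is closed downwards inside f(χ(Γ^{<0})): if z = χ(y) with y < 0 and
  -- f z < d = χ(s) ∈ Δ, then f z = χ(f y + s) with f y + s = f(y + x) + q·a.
  Δ-downward : ∀ z {d} → G.InχNeg z → Δ e a d → f z M.< d → Δ e a (f z)
  Δ-downward z {d} (y , y<0 , χy≡z) (q , x , q≢0 , s<0 , χs≡d) fz<d =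
    q , y G.+ x , q≢0 , subst (M._< M.0#) (sym regroup) sum<0 ,
    trans (cong M.χ regroup) (trans (sym (VM.V-nonpos (inj₁ sum<0))) (trans V-sum Vfy≡fz))
    where
    s = f x M.+ q ·ℚ a
    regroup : f (y G.+ x) M.+ q ·ℚ a ≡ f y M.+ s
    regroup = trans (cong (M._+ q ·ℚ a) (f-+ y x)) (M.+-assoc _ _ _)
    fy<0 : f y M.< M.0#
    fy<0 = f-neg y<0
    sum<0 : f y M.+ s M.< M.0#
    sum<0 = M.<-trans (subst (f y M.+ s M.<_) (M.+-identityˡ s) (M.+-mono-< s fy<0)) s<0
    Vfy≡fz : VM.V (f y) ≡ f z
    Vfy≡fz = trans (VM.V-nonpos (inj₁ fy<0)) (trans (sym (f-χ y)) (cong f χy≡z))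
    Vs≡d : VM.V s ≡ d
    Vs≡d = trans (VM.V-nonpos (inj₁ s<0)) χs≡d
    V-sum : VM.V (f y M.+ s) ≡ VM.V (f y)
    V-sum = VM.V-dominant (f y) s (subst₂ M._<_ (sym Vfy≡fz) (sym Vs≡d) fz<d)

-- The three cases of the theorem exclude each other, for any a: case (3)
-- puts a point outside Γ into Δ, which cases (1) and (2) forbid, and a
-- special cut B containing b also contains χ(b) > b, so it is not of the
-- form {x ≤ b}.
module Exclusivity {G M : Model} (e : Embedding G M) (a : Model.Carrier M) where
  private
    module G = Model G
    module M = Model M
    module OG = OrderedGroup G
    module VG = Valuation G
  open Embedding e

  not-case1-and-case2 : ¬ (Case1 e a × Case2 e a)
  not-case1-and-case2 ((B , (_ , _ , χ-closed , _) , Δ≐B) , (b , b∈ , Δ≐≤b)) =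
    G.<-irrefl _ (OG.<-≤-trans (VG.χNeg<χ b∈) χb≤b)
    where
    Bb : B b
    Bb with proj₁ (Δ≐B (f b)) (proj₂ (Δ≐≤b (f b)) (b , (b∈ , inj₂ refl) , refl))
    ... | (z , Bz , fz≡fb) = subst B (f-inj _ _ fz≡fb) Bz
    χb≤b : G.χ b G.≤ b
    χb≤b with proj₁ (Δ≐≤b (f (G.χ b))) (proj₂ (Δ≐B (f (G.χ b))) (G.χ b , χ-closed b Bb , refl))
    ... | (z , (_ , z≤b) , fz≡fχb) = subst (G._≤ b) (f-inj _ _ fz≡fχb) z≤b

  not-case1-and-case3 : ¬ (Case1 e a × Case3 e a)
  not-case1-and-case3 ((B , (B⊆χNeg , _) , Δ≐B) , (_ , _ , b , _ , b∉ , _ , _ , Δ≡B∪b))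
    with proj₁ (Δ≐B b) (proj₂ (Δ≡B∪b b) (inj₂ refl))
  ... | (z , Bz , fz≡b) = b∉ (z , B⊆χNeg z Bz , fz≡b)

  not-case2-and-case3 : ¬ (Case2 e a × Case3 e a)
  not-case2-and-case3 ((_ , _ , Δ≐≤b) , (_ , _ , b , _ , b∉ , _ , _ , Δ≡B∪b))
    with proj₁ (Δ≐≤b b) (proj₂ (Δ≡B∪b b) (inj₂ refl))
  ... | (z , (z∈ , _) , fz≡b) = b∉ (z , z∈ , fz≡b)

-- Let B = f⁻¹(Δ).  By the facts on Δ, B is a lower
-- cut in χ(Γ^{<0}), and χ(z) ∈ B as soon as f z lies strictly below some
-- element of Δ.  If Δ has a point b outside Γ, it is the maximum of Δ and
-- we are in case (3); otherwise Δ = f(B), and we are in case (2) or (1)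
-- according as B has a maximum or not.
module Existence (lem : ExcludedMiddle 0ℓ) {G M : Model} (e : Embedding G M) (a : Model.Carrier M)
                 (a∉Γ : ¬ (Σ (Model.Carrier G) λ x → Embedding.f e x ≡ a)) where
  private
    module G = Model G
    module M = Model M
  open Embedding e
  open EmbeddingFacts e
  open DeltaSet e a a∉Γ

  B : G.Carrier → Set
  B z = Δ e a (f z)

  B⊆χNeg : ∀ z → B z → G.InχNeg z
  B⊆χNeg z Bz = f-reflects-χNeg lem z (Δ⊆χNeg Bz)

  B-lower : ∀ z₁ z₂ → B z₂ → G.InχNeg z₁ → z₁ G.< z₂ → B z₁
  B-lower z₁ z₂ Bz₂ z₁∈ z₁<z₂ = Δ-downward z₁ z₁∈ Bz₂ (f-< z₁ z₂ z₁<z₂)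

  -- Since f z < χ(f z) ≤ d by axiom (iii) in M, χ(z) ∈ B by downward closure.
  B-χ-step : ∀ {z d} → B z → Δ e a d → f z M.< d → B (G.χ z)
  B-χ-step {z} {d} Bz Δd fz<d with proj₂ (M.χ-between (f z) d (Δ⊆χNeg Bz) (Δ⊆χNeg Δd) fz<d)
  ... | inj₁ χfz<d = Δ-downward (G.χ z) (proj₁ (G.χ-into z (B⊆χNeg z Bz))) Δd
                       (subst (M._< d) (sym (f-χ z)) χfz<d)
  ... | inj₂ χfz≡d = subst (Δ e a) (sym (trans (f-χ z) χfz≡d)) Δd

  case3 : ∀ b → Δ e a b → ¬ InImage b → Case3 e a
  case3 b Δb b∉ =
    B , (B⊆χNeg , B-lower , (λ z Bz → B-χ-step Bz Δb (B<b z Bz)) , (G.c , Bc)) ,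
    b , Δ⊆χNeg Δb , (λ (z , _ , fz≡b) → b∉ (z , fz≡b)) , B<b , b<rest , Δ≡B∪b
    where
    B<b : ∀ z → B z → f z M.< b
    B<b z Bz with M.<-total (f z) b
    ... | inj₁ fz<b        = fz<b
    ... | inj₂ (inj₁ fz≡b) = ⊥-elim (b∉ (z , fz≡b))
    ... | inj₂ (inj₂ b<fz) = let (g , _ , fg≡b) = Δ-smaller-in-image Bz Δb b<fz in ⊥-elim (b∉ (g , fg≡b))
    Bc : B G.c
    Bc with M.c-least b (Δ⊆χNeg Δb)
    ... | inj₁ c<b = Δ-downward G.c G.c-in Δb (subst (M._< b) (sym f-c) c<b)
    ... | inj₂ c≡b = ⊥-elim (b∉ (G.c , trans f-c c≡b))
    b<rest : ∀ z → G.InχNeg z → ¬ B z → b M.< f z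
    b<rest z z∈ ¬Bz with M.<-total (f z) b
    ... | inj₁ fz<b        = ⊥-elim (¬Bz (Δ-downward z z∈ Δb fz<b))
    ... | inj₂ (inj₁ fz≡b) = ⊥-elim (b∉ (z , fz≡b))
    ... | inj₂ (inj₂ b<fz) = b<fz
    Δ≡B∪b : ∀ y → (Δ e a y → (Σ G.Carrier λ z → B z × f z ≡ y) ⊎ y ≡ b)
                × ((Σ G.Carrier λ z → B z × f z ≡ y) ⊎ y ≡ b → Δ e a y)
    Δ≡B∪b y = to , from
      where
      to : Δ e a y → (Σ G.Carrier λ z → B z × f z ≡ y) ⊎ y ≡ b
      to Δy with lem {InImage y}
      ... | yes (z , fz≡y) = inj₁ (z , subst (Δ e a) (sym fz≡y) Δy , fz≡y)
      ... | no y∉          = inj₂ (Δ-unique-outside-image Δy Δb y∉ b∉)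
      from : (Σ G.Carrier λ z → B z × f z ≡ y) ⊎ y ≡ b → Δ e a y
      from (inj₁ (z , Bz , fz≡y)) = subst (Δ e a) fz≡y Bz
      from (inj₂ refl)            = Δb

  Δ≐B : (∀ y → Δ e a y → InImage y) → _≐img_ e (Δ e a) B
  Δ≐B Δ⊆Γ y = (λ Δy → let (z , fz≡y) = Δ⊆Γ y Δy in z , subst (Δ e a) (sym fz≡y) Δy , fz≡y)
            , (λ (z , Bz , fz≡y) → subst (Δ e a) fz≡y Bz)

  case2 : (∀ y → Δ e a y → InImage y) → ∀ b → B b → (∀ z → B z → z G.≤ b) → Case2 e a
  case2 Δ⊆Γ b Bb b-max = b , B⊆χNeg b Bb , λ y →
      (λ Δy → let (z , Bz , fz≡y) = proj₁ (Δ≐B Δ⊆Γ y) Δy in z , (B⊆χNeg z Bz , b-max z Bz) , fz≡y)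
    , λ (z , (z∈ , z≤b) , fz≡y) → subst (Δ e a) fz≡y (below-b z z∈ z≤b)
    where
    below-b : ∀ z → G.InχNeg z → z G.≤ b → B z
    below-b z z∈ (inj₁ z<b) = B-lower z b Bb z∈ z<b
    below-b z z∈ (inj₂ refl) = Bb

  larger-in-B : ¬ (Σ G.Carrier λ b → B b × (∀ z → B z → z G.≤ b)) →
    ∀ z → B z → Σ G.Carrier λ z' → B z' × z G.< z'
  larger-in-B no-max z Bz with lem {Σ G.Carrier λ z' → B z' × z G.< z'}
  ... | yes larger = larger
  ... | no none = ⊥-elim (no-max (z , Bz , z-max))
    where
    z-max : ∀ z' → B z' → z' G.≤ z
    z-max z' Bz' with G.<-total z' z
    ... | inj₁ z'<z        = inj₁ z'<z
    ... | inj₂ (inj₁ z'≡z) = inj₂ z'≡z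
    ... | inj₂ (inj₂ z<z') = ⊥-elim (none (z' , Bz' , z<z'))

  case1 : (∀ y → Δ e a y → InImage y) → ¬ (Σ G.Carrier λ b → B b × (∀ z → B z → z G.≤ b)) → Case1 e a
  case1 Δ⊆Γ no-max = B , (B⊆χNeg , B-lower , χ-closed , nonempty) , Δ≐B Δ⊆Γ
    where
    χ-closed : ∀ z → B z → B (G.χ z)
    χ-closed z Bz = let (z' , Bz' , z<z') = larger-in-B no-max z Bz in B-χ-step Bz Bz' (f-< z z' z<z')
    nonempty : Σ G.Carrier B
    nonempty = let (y , Δy) = Δ-nonempty ; (z , Bz , _) = proj₁ (Δ≐B Δ⊆Γ y) Δy in z , Bz

  inside-Γ : ¬ (Σ M.Carrier λ b → Δ e a b × ¬ InImage b) → ∀ y → Δ e a y → InImage y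
  inside-Γ no-outside y Δy with lem {InImage y}
  ... | yes y∈ = y∈
  ... | no y∉  = ⊥-elim (no-outside (y , Δy , y∉))

  some-case : Case1 e a ⊎ Case2 e a ⊎ Case3 e a
  some-case with lem {Σ M.Carrier λ b → Δ e a b × ¬ InImage b}
  ... | yes (b , Δb , b∉) = inj₂ (inj₂ (case3 b Δb b∉))
  ... | no no-outside with lem {Σ G.Carrier λ b → B b × (∀ z → B z → z G.≤ b)}
  ...   | yes (b , Bb , b-max) = inj₂ (inj₁ (case2 (inside-Γ no-outside) b Bb b-max))
  ...   | no no-max            = inj₁ (case1 (inside-Γ no-outside) no-max)

mainTheorem17 : ExcludedMiddle 0ℓ → (M G : Model) (e : Embedding G M) →
    (a : Model.Carrier M) →
    ¬ (Σ (Model.Carrier G) λ x → Embedding.f e x ≡ a) →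
    ExactlyOne (Case1 e a) (Case2 e a) (Case3 e a)
mainTheorem17 lem M G e a a∉Γ = some-case , not-case1-and-case2 , not-case1-and-case3 , not-case2-and-case3
  where
  open Existence lem e a a∉Γ using (some-case)
  open Exclusivity e a
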